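{- The categories $\mathbf{CIS}$ and $\mathbf{SCIS}$ are equivalent.
   Context: A simplified continuous information system is a triple $(S,\mathrm{CON},\Vdash)$ with $S$ a set, $\mathrm{CON}$ a collection of finite subsets of $S$ and $\Vdash\subseteq\mathrm{CON}\times S$, such that for all $X,Y\in\mathrm{CON}$, $a\in S$ and finite $F\subseteq S$ (writing $X\Vdash Y$ iff $X\Vdash b$ for all $b\in Y$): (1) $\{a\}\in\mathrm{CON}$; (2) if $X\subseteq Y$ and $X\Vdash a$ then $Y\Vdash a$; (3) if $X\Vdash Y$ and $Y\Vdash a$ then $X\Vdash a$; (4) if $X\Vdash a$ then there is $Z\in\mathrm{CON}$ with $X\Vdash Z$ and $Z\Vdash a$; (5) if $X\Vdash F$ then there is $Z\in\mathrm{CON}$ with $F\subseteq Z$ and $X\Vdash Z$. It is a continuous information system if moreover $X\Vdash a$ implies $X\cup\{a\}\in\mathrm{CON}$. An approximable mapping $H$ from $(S,\mathrm{CON},\Vdash)$ to $(S',\mathrm{CON}',\Vdash')$ is a relation $H\subseteq\mathrm{CON}\times S'$ (write $XHF$ iff $XHb$ for all $b\in F$) such that for all $X,X'\in\mathrm{CON}$, $Y\in\mathrm{CON}'$, $b\in S'$ and finite $F\subseteq S'$: (a) $XHY$ and $Y\Vdash' b$ imply $XHb$; (b) $X\supseteq X'$ and $X'Hb$ imply $XHb$; (c) $X\Vdash X'$ and $X'Hb$ imply $XHb$; (d) if $XHb$ there are $Z\in\mathrm{CON}$, $Z'\in\mathrm{CON}'$ with $X\Vdash Z$, $ZHZ'$,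 $Z'\Vdash' b$; (e) if $XHF$ there is $Z\in\mathrm{CON}'$ with $F\subseteq Z$ and $XHZ$. $\mathbf{SCIS}$ is the category of simplified continuous information systems and approximable mappings (composition = relational composition, identity on $\mathbb S$ = its $\Vdash$); $\mathbf{CIS}$ is its full subcategory of continuous information systems. -}

module Defs where

open import Data.List using (List; []; _∷_)
open import Data.List.Membership.Propositional using (_∈_)
open import Data.List.Relation.Binary.Subset.Propositional using (_⊆_)
open import Data.Product using (Σ; _×_; _,_; proj₁; proj₂)
open import Data.Unit using (⊤)

-- Finite subsets of S are represented by lists; "subset" is list-membership
-- inclusion.  CON is required to be invariant under having the same elements.

record SCIS : Set₁ where
  field
    S    : Set
    Con  : List S → Set
    _⊩_  : List S → S → Set

  _⊩*_ : List S → List S → Set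
  X ⊩* Y = ∀ {b} → b ∈ Y → X ⊩ b

  field
    -- CON is a collection of finite *sets* (list order/duplicates irrelevant)
    Con-ext : ∀ {X Y} → X ⊆ Y → Y ⊆ X → Con X → Con Y
    ⊩-Con   : ∀ {X a} → X ⊩ a → Con X
    sing    : ∀ a → Con (a ∷ [])
    mono    : ∀ {X Y a} → Con X → Con Y → X ⊆ Y → X ⊩ a → Y ⊩ a
    trans   : ∀ {X Y a} → Con X → Con Y → X ⊩* Y → Y ⊩ a → X ⊩ a
    interp  : ∀ {X a} → Con X → X ⊩ a →
              Σ (List S) λ Z → Con Z × (X ⊩* Z) × (Z ⊩ a)
    fin     : ∀ {X} {F : List S} → Con X → X ⊩* F →
              Σ (List S) λ Z → Con Z × (F ⊆ Z) × (X ⊩* Z)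

open SCIS public

IsCIS : SCIS → Set
IsCIS A = ∀ {X a} → Con A X → _⊩_ A X a → Con A (a ∷ X)

Rel : SCIS → SCIS → Set₁
Rel A B = List (S A) → S B → Set

HL : ∀ A B → Rel A B → List (S A) → List (S B) → Set
HL A B H X Y = ∀ {b} → b ∈ Y → H X b

record Approx (A B : SCIS) : Set₁ where
  field
    H     : Rel A B
    H-Con : ∀ {X b} → H X b → Con A X
    ax-a  : ∀ {X Y b} → Con A X → Con B Y → HL A B H X Y → _⊩_ B Y b → H X b
    ax-b  : ∀ {X X' b} → Con A X → Con A X' → X' ⊆ X → H X' b → H X b
    ax-c  : ∀ {X X' b} → Con A X → Con A X' → _⊩*_ A X X' → H X' b → H X b
    ax-d  : ∀ {X b} → Con A X → H X b →
            Σ (List (S A)) λ Z → Σ (List (S B)) λ Z' →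
              Con A Z × Con B Z' × _⊩*_ A X Z × HL A B H Z Z' × _⊩_ B Z' b
    ax-e  : ∀ {X} {F : List (S B)} → Con A X → HL A B H X F →
            Σ (List (S B)) λ Z → Con B Z × (F ⊆ Z) × HL A B H X Z

open Approx public

idRel : (A : SCIS) → Rel A A
idRel A = _⊩_ A

comp : ∀ A B C → Rel B C → Rel A B → Rel A C
comp A B C G H X c = Con A X × Σ (List (S B)) λ Y → Con B Y × HL A B H X Y × G Y c

EqR : ∀ A B → Rel A B → Rel A B → Set
EqR A B R R' = ∀ X c → (R X c → R' X c) × (R' X c → R X c)

-- Full subcategories of SCIS given by a predicate on objects.
-- SCIS itself is  Ob (λ _ → ⊤),  CIS is  Ob IsCIS.

Ob : (SCIS → Set) → Set₁
Ob P = Σ SCIS P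

U : ∀ {P} → Ob P → SCIS
U = proj₁

record Functor (P Q : SCIS → Set) : Set₁ where
  field
    F₀     : Ob P → Ob Q
    F₁     : ∀ {A B} → Approx (U A) (U B) → Approx (U (F₀ A)) (U (F₀ B))
    F-resp : ∀ {A B} (f g : Approx (U A) (U B)) →
             EqR (U A) (U B) (H f) (H g) →
             EqR (U (F₀ A)) (U (F₀ B)) (H (F₁ f)) (H (F₁ g))
    F-id   : ∀ {A} (i : Approx (U A) (U A)) →
             EqR (U A) (U A) (H i) (idRel (U A)) →
             EqR (U (F₀ A)) (U (F₀ A)) (H (F₁ i)) (idRel (U (F₀ A)))
    F-comp : ∀ {A B C} (f : Approx (U A) (U B)) (g : Approx (U B) (U C))
               (h : Approx (U A) (U C)) →
             EqR (U A) (U C) (H h) (comp (U A) (U B) (U C) (H g) (H f)) →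
             EqR (U (F₀ A)) (U (F₀ C)) (H (F₁ h))
               (comp (U (F₀ A)) (U (F₀ B)) (U (F₀ C)) (H (F₁ g)) (H (F₁ f)))

open Functor public

IdF : ∀ {P} → Functor P P
IdF = record
  { F₀ = λ A → A ; F₁ = λ f → f
  ; F-resp = λ f g e → e ; F-id = λ i e → e ; F-comp = λ f g h e → e }

_∘F_ : ∀ {P Q R} → Functor Q R → Functor P Q → Functor P R
G ∘F F = record
  { F₀ = λ A → F₀ G (F₀ F A)
  ; F₁ = λ f → F₁ G (F₁ F f)
  ; F-resp = λ f g e → F-resp G (F₁ F f) (F₁ F g) (F-resp F f g e)
  ; F-id = λ i e → F-id G (F₁ F i) (F-id F i e)
  ; F-comp = λ f g h e → F-comp G (F₁ F f) (F₁ F g) (F₁ F h) (F-comp F f g h e) }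

record NatIso {P Q} (F G : Functor P Q) : Set₁ where
  field
    η     : ∀ A → Approx (U (F₀ F A)) (U (F₀ G A))
    η⁻¹   : ∀ A → Approx (U (F₀ G A)) (U (F₀ F A))
    isoˡ  : ∀ A → EqR (U (F₀ F A)) (U (F₀ F A))
              (comp (U (F₀ F A)) (U (F₀ G A)) (U (F₀ F A)) (H (η⁻¹ A)) (H (η A)))
              (idRel (U (F₀ F A)))
    isoʳ  : ∀ A → EqR (U (F₀ G A)) (U (F₀ G A))
              (comp (U (F₀ G A)) (U (F₀ F A)) (U (F₀ G A)) (H (η A)) (H (η⁻¹ A)))
              (idRel (U (F₀ G A)))
    natural : ∀ {A B} (f : Approx (U A) (U B)) →
              EqR (U (F₀ F A)) (U (F₀ G B))
                (comp (U (F₀ F A)) (U (F₀ F B)) (U (F₀ G B)) (H (η B)) (H (F₁ F f)))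
                (comp (U (F₀ F A)) (U (F₀ G A)) (U (F₀ G B)) (H (F₁ G f)) (H (η A)))

record Equivalence (P Q : SCIS → Set) : Set₁ where
  field
    F    : Functor P Q
    G    : Functor Q P
    unit   : NatIso (G ∘F F) IdF
    counit : NatIso (F ∘F G) IdF

CIS-pred SCIS-pred : SCIS → Set
CIS-pred = IsCIS
SCIS-pred _ = ⊤

{-# OPTIONS --safe #-}
module Submission where

open import Defs
open import Data.List using (List; []; _∷_; _++_)
open import Data.List.Membership.Propositional using (_∈_)
open import Data.List.Membership.Propositional.Properties using (∈-++⁺ˡ; ∈-++⁺ʳ; ∈-++⁻)
open import Data.List.Relation.Binary.Subset.Propositional using (_⊆_)
open import Data.List.Relation.Unary.Any using (here; there)
open import Data.Product using (Σ; Σ-syntax; _×_; _,_; proj₁; proj₂)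
open import Data.Sum using ([_,_])
open import Data.Unit using (tt)
open import Function using (_∘_; id)
open import Relation.Binary.PropositionalEquality using (refl)

-- Every simplified continuous information system A is isomorphic in SCIS to a
-- continuous one.  Its tokens are the consistent sets of A, preordered by
-- X ≼ Y iff Y entails everything X entails; a finite family of tokens is
-- consistent when it has a ≼-greatest member, and it entails a token when its
-- greatest member entails all of that token.  Adding an entailed token keeps
-- the greatest member greatest, which is the extra axiom of a continuous
-- system.  The isomorphism relates X to the tokens it entails, and a family to
-- what its greatest member entails.  So the inclusion CIS → SCIS is full,
-- faithful and essentially surjective, with quasi-inverse acting on a mapping
-- by relating a family to the tokens its greatest member is mapped onto.

ConHull : ∀ {Y : Set} → (List Y → Set) → (Y → Set) → Set
ConHull {Y} Con Q = ∀ {F} → (∀ {z} → z ∈ F → Q z) →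
                    Σ[ Z ∈ List Y ] Con Z × F ⊆ Z × (∀ {z} → z ∈ Z → Q z)

amalgamate : ∀ {Y I : Set} {Con : List Y → Set} (Q : Y → Set) (P : List Y → I → Set) →
             ConHull Con Q →
             (∀ {Z W i} → Con Z → Con W → Z ⊆ W → P Z i → P W i) →
             (is : List I) →
             (∀ {i} → i ∈ is → Σ[ Z ∈ List Y ] Con Z × (∀ {z} → z ∈ Z → Q z) × P Z i) →
             Σ[ W ∈ List Y ] Con W × (∀ {z} → z ∈ W → Q z) × (∀ {i} → i ∈ is → P W i)
amalgamate Q P close P-mono [] _ =
  let (Z , cZ , _ , qZ) = close {[]} (λ ()) in Z , cZ , qZ , λ ()
amalgamate Q P close P-mono (i ∷ is) pick =
  let (Z , cZ , qZ , pZ) = pick (here refl)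
      (V , cV , qV , pV) = amalgamate Q P close P-mono is (pick ∘ there)
      (W , cW , Z++V⊆W , qW) = close {Z ++ V} ([ qZ , qV ] ∘ ∈-++⁻ Z)
  in W , cW , qW , λ { (here refl) → P-mono cZ cW (Z++V⊆W ∘ ∈-++⁺ˡ) pZ
                     ; (there p) → P-mono cV cW (Z++V⊆W ∘ ∈-++⁺ʳ Z) (pV p) }

module _ (A : SCIS) where
  private module A = SCIS A

  interpolate : ∀ {X Y} → A.Con X → X A.⊩* Y →
                Σ[ W ∈ List A.S ] A.Con W × X A.⊩* W × W A.⊩* Y
  interpolate {X} {Y} cX X⊩Y =
    amalgamate (X A.⊩_) A._⊩_ (A.fin cX) A.mono Y (λ p → A.interp cX (X⊩Y p))

module _ {A B : SCIS} (f : Approx A B) where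
  private
    module A = SCIS A
    module B = SCIS B

  _⟶*_ : List A.S → List B.S → Set
  _⟶*_ = HL A B (H f)

  interpolate-left : ∀ {X b} → A.Con X → H f X b →
                     Σ[ Z ∈ List A.S ] A.Con Z × X A.⊩* Z × H f Z b
  interpolate-left cX Xb =
    let (Z , Z′ , cZ , cZ′ , X⊩Z , Z⟶Z′ , Z′⊩b) = ax-d f cX Xb
    in Z , cZ , X⊩Z , ax-a f cZ cZ′ Z⟶Z′ Z′⊩b

  interpolate-right : ∀ {X b} → A.Con X → H f X b →
                      Σ[ Z′ ∈ List B.S ] B.Con Z′ × X ⟶* Z′ × Z′ B.⊩ b
  interpolate-right cX Xb =
    let (Z , Z′ , cZ , cZ′ , X⊩Z , Z⟶Z′ , Z′⊩b) = ax-d f cX Xb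
    in Z′ , cZ′ , (λ p → ax-c f cX cZ X⊩Z (Z⟶Z′ p)) , Z′⊩b

  factor-left : ∀ {X Y} → A.Con X → X ⟶* Y →
                Σ[ V ∈ List A.S ] A.Con V × X A.⊩* V × V ⟶* Y
  factor-left {X} {Y} cX X⟶Y =
    amalgamate (X A.⊩_) (H f) (A.fin cX) (λ cZ cW → ax-b f cW cZ) Y
               (λ p → interpolate-left cX (X⟶Y p))

  factor-right : ∀ {X Y} → A.Con X → X ⟶* Y →
                 Σ[ W ∈ List B.S ] B.Con W × X ⟶* W × W B.⊩* Y
  factor-right {X} {Y} cX X⟶Y =
    amalgamate (H f X) B._⊩_ (ax-e f cX) B.mono Y (λ p → interpolate-right cX (X⟶Y p))

comp-factor : ∀ {A B C} (f : Approx A B) (g : Approx B C) {X Y} → Con A X →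
              (∀ {c} → c ∈ Y → comp A B C (H g) (H f) X c) →
              Σ[ Z ∈ List (S B) ] Con B Z × HL A B (H f) X Z × HL B C (H g) Z Y
comp-factor f g {X} {Y} cX X→Y =
  amalgamate (H f X) (H g) (ax-e f cX) (λ cZ cW → ax-b g cW cZ) Y (proj₂ ∘ X→Y)

Token : SCIS → Set
Token A = Σ (List (S A)) (Con A)

module ToCIS (A : SCIS) where
  private module A = SCIS A

  _≼_ : List A.S → List A.S → Set
  X ≼ Y = ∀ {b} → X A.⊩ b → Y A.⊩ b

  ⊩*⇒≽ : ∀ {X Y} → A.Con X → A.Con Y → X A.⊩* Y → Y ≼ X
  ⊩*⇒≽ cX cY X⊩Y = A.trans cX cY X⊩Y

  IsGreatest : List (Token A) → Token A → Set
  IsGreatest L M = M ∈ L × (∀ {X} → X ∈ L → proj₁ X ≼ proj₁ M)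

  greatest-mono : ∀ {L L′ M M′} → L′ ⊆ L → IsGreatest L M → IsGreatest L′ M′ →
                  proj₁ M′ ≼ proj₁ M
  greatest-mono L′⊆L (_ , below-M) (M′∈L′ , _) = below-M (L′⊆L M′∈L′)

  greatest-∷ : ∀ (W : Token A) {F} → (∀ {T} → T ∈ F → proj₁ W A.⊩* proj₁ T) →
               IsGreatest (W ∷ F) W
  greatest-∷ W W⊩F = here refl , λ { (here refl) → id
                                   ; {T} (there p) → ⊩*⇒≽ (proj₂ W) (proj₂ T) (W⊩F p) }

  greatest-singleton : ∀ (W : Token A) → IsGreatest (W ∷ []) W
  greatest-singleton W = greatest-∷ W (λ ())

  singleton-con : ∀ (W : Token A) → Σ (Token A) (IsGreatest (W ∷ []))
  singleton-con W = W , greatest-singleton W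

  AtGreatest : ∀ {I : Set} → (List A.S → I → Set) → List (Token A) → I → Set
  AtGreatest R L i = Σ[ M ∈ Token A ] IsGreatest L M × R (proj₁ M) i

  -- A record rather than a Π-type, so that R can be inferred from a proof of Upward R.
  record Upward {I : Set} (R : List A.S → I → Set) : Set where
    field ≼-closed : ∀ {X Y i} → A.Con X → A.Con Y → X ≼ Y → R X i → R Y i
  open Upward

  Every : ∀ {I : Set} → (List A.S → I → Set) → List A.S → List I → Set
  Every R X is = ∀ {i} → i ∈ is → R X i

  lift : ∀ {I : Set} → (List A.S → I → Set) → List (Token A) → List I → Set
  lift R = AtGreatest (Every R)

  ⊩-upward : Upward A._⊩_
  ⊩-upward .≼-closed _ _ X≼Y = X≼Y

  Every-upward : ∀ {I} {R : List A.S → I → Set} → Upward R → Upward (Every R)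
  Every-upward up .≼-closed cX cY X≼Y XR p = ≼-closed up cX cY X≼Y (XR p)

  ⊩*-upward : Upward A._⊩*_
  ⊩*-upward = Every-upward ⊩-upward

  at-greatest : ∀ {I} {R : List A.S → I → Set} {L M i} → Upward R →
                IsGreatest L M → AtGreatest R L i → R (proj₁ M) i
  at-greatest {M = M} up M-max (M₀ , M₀-max , R) =
    ≼-closed up (proj₂ M₀) (proj₂ M) (greatest-mono id M-max M₀-max) R

  lift-cong : ∀ {I} {R R′ : List A.S → I → Set} →
              (∀ X i → (R X i → R′ X i) × (R′ X i → R X i)) →
              ∀ L is → (lift R L is → lift R′ L is) × (lift R′ L is → lift R L is)
  lift-cong R⇔R′ L is = (λ (M , M-max , R) → M , M-max , proj₁ (R⇔R′ _ _) ∘ R)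
                      , (λ (M , M-max , R′) → M , M-max , proj₂ (R⇔R′ _ _) ∘ R′)

  _⊩ᶜ_ : List (Token A) → Token A → Set
  L ⊩ᶜ T = lift A._⊩_ L (proj₁ T)

  AtGreatest-⊆ : ∀ {I} {R : List A.S → I → Set} {L L′ M i} → Upward R →
                 L′ ⊆ L → IsGreatest L M → AtGreatest R L′ i → AtGreatest R L i
  AtGreatest-⊆ {M = M} up L′⊆L M-max (M′ , M′-max , R) =
    M , M-max , ≼-closed up (proj₂ M′) (proj₂ M) (greatest-mono L′⊆L M-max M′-max) R

  AtGreatest-⊩ : ∀ {I} {R : List A.S → I → Set} {L L′ M i} → Upward R →
                 IsGreatest L M → (∀ {T} → T ∈ L′ → L ⊩ᶜ T) →
                 AtGreatest R L′ i → AtGreatest R L i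
  AtGreatest-⊩ {M = M} up M-max L⊩L′ (N , (N∈L′ , _) , R) =
    M , M-max , ≼-closed up (proj₂ N) (proj₂ M) N≼M R
    where
    N≼M : proj₁ N ≼ proj₁ M
    N≼M = ⊩*⇒≽ (proj₂ M) (proj₂ N) (at-greatest ⊩*-upward M-max (L⊩L′ N∈L′))

  extend-with-greatest :
    ∀ {Q : A.S → Set} {F} →
    ConHull A.Con Q →
    (∀ {T} → T ∈ F → Σ[ Z ∈ List A.S ] A.Con Z × (∀ {z} → z ∈ Z → Q z) × Z A.⊩* proj₁ T) →
    Σ[ W ∈ Token A ] (∀ {z} → z ∈ proj₁ W → Q z) × IsGreatest (W ∷ F) W
  extend-with-greatest {Q} {F} close pick =
    let (W , cW , QW , W⊩F) = amalgamate Q (λ W T → W A.⊩* proj₁ T) close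
                                (λ cZ cW Z⊆W Z⊩T → A.mono cZ cW Z⊆W ∘ Z⊩T) F pick
    in (W , cW) , QW , greatest-∷ (W , cW) W⊩F

  system : SCIS
  system = record
    { S = Token A
    ; Con = λ L → Σ (Token A) (IsGreatest L)
    ; _⊩_ = _⊩ᶜ_
    ; Con-ext = λ { L⊆L′ L′⊆L (M , M∈L , below-M) → M , L⊆L′ M∈L , below-M ∘ L′⊆L }
    ; ⊩-Con = λ { (M , M-max , _) → M , M-max }
    ; sing = singleton-con
    ; mono = λ { _ (M , M-max) L⊆L′ → AtGreatest-⊆ ⊩*-upward L⊆L′ M-max }
    ; trans = λ { (M , M-max) _ → AtGreatest-⊩ ⊩*-upward M-max }
    ; interp = λ { _ (M , M-max , M⊩T) →
        let (W , cW , M⊩W , W⊩T) = interpolate A (proj₂ M) M⊩T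
        in (W , cW) ∷ [] , singleton-con (W , cW)
           , (λ { (here refl) → M , M-max , M⊩W })
           , ((W , cW) , greatest-singleton (W , cW) , W⊩T) }
    ; fin = λ { {F = F} (M , M-max) L⊩F →
        let (W , M⊩W , W-max) = extend-with-greatest (A.fin (proj₂ M))
              (λ p → interpolate A (proj₂ M) (at-greatest ⊩*-upward M-max (L⊩F p)))
        in W ∷ F , (W , W-max) , there
           , λ { (here refl) → M , M-max , M⊩W ; (there p) → L⊩F p } }
    }

  isCIS : IsCIS system
  isCIS {_} {T} _ (M , (M∈L , below-M) , M⊩T) =
    M , there M∈L , λ { (here refl) → ⊩*⇒≽ (proj₂ M) (proj₂ T) M⊩T ; (there p) → below-M p }

  from : Approx system A
  from = record
    { H = AtGreatest A._⊩_
    ; H-Con = λ { (M , M-max , _) → M , M-max }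
    ; ax-a = λ { (M , M-max) cY L→Y Y⊩b →
        M , M-max , A.trans (proj₂ M) cY (at-greatest ⊩-upward M-max ∘ L→Y) Y⊩b }
    ; ax-b = λ { (M , M-max) _ L′⊆L → AtGreatest-⊆ ⊩-upward L′⊆L M-max }
    ; ax-c = λ { (M , M-max) _ → AtGreatest-⊩ ⊩-upward M-max }
    ; ax-d = λ { _ (M , M-max , M⊩b) →
        let (W , cW , M⊩W , W⊩b) = A.interp (proj₂ M) M⊩b
            (V , cV , M⊩V , V⊩W) = interpolate A (proj₂ M) M⊩W
        in (V , cV) ∷ [] , W , singleton-con (V , cV) , cW
           , (λ { (here refl) → M , M-max , M⊩V })
           , (λ p → (V , cV) , greatest-singleton (V , cV) , V⊩W p) , W⊩b }
    ; ax-e = λ { (M , M-max) L→F →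
        let (Z , cZ , F⊆Z , M⊩Z) = A.fin (proj₂ M) (at-greatest ⊩-upward M-max ∘ L→F)
        in Z , cZ , F⊆Z , λ p → M , M-max , M⊩Z p }
    }

  to : Approx A system
  to = record
    { H = λ X T → A.Con X × X A.⊩* proj₁ T
    ; H-Con = proj₁
    ; ax-a = λ { cX _ X→L (N , (N∈L , _) , N⊩T) →
        cX , A.trans cX (proj₂ N) (proj₂ (X→L N∈L)) ∘ N⊩T }
    ; ax-b = λ { cX cX′ X′⊆X (_ , X′⊩T) → cX , A.mono cX′ cX X′⊆X ∘ X′⊩T }
    ; ax-c = λ { cX cX′ X⊩X′ (_ , X′⊩T) → cX , A.trans cX cX′ X⊩X′ ∘ X′⊩T }
    ; ax-d = λ { cX (_ , X⊩T) →
        let (W , cW , X⊩W , W⊩T) = interpolate A cX X⊩T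
            (V , cV , X⊩V , V⊩W) = interpolate A cX X⊩W
        in V , (W , cW) ∷ [] , cV , singleton-con (W , cW) , X⊩V
           , (λ { (here refl) → cV , V⊩W }) , ((W , cW) , greatest-singleton (W , cW) , W⊩T) }
    ; ax-e = λ { {F = F} cX X→F →
        let (W , X⊩W , W-max) = extend-with-greatest (A.fin cX)
              (λ p → interpolate A cX (proj₂ (X→F p)))
        in W ∷ F , (W , W-max) , there , λ { (here refl) → cX , X⊩W ; (there p) → X→F p } }
    }

  from∘to≈id : EqR A A (comp A system A (H from) (H to)) A._⊩_
  from∘to≈id X b = forth , back
    where
    forth : comp A system A (H from) (H to) X b → X A.⊩ b
    forth (cX , _ , _ , X→L , (M , (M∈L , _) , M⊩b)) =
      A.trans cX (proj₂ M) (proj₂ (X→L M∈L)) M⊩b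
    back : X A.⊩ b → comp A system A (H from) (H to) X b
    back X⊩b =
      let cX = A.⊩-Con X⊩b
          (Z , cZ , X⊩Z , Z⊩b) = A.interp cX X⊩b
      in cX , (Z , cZ) ∷ [] , singleton-con (Z , cZ)
         , (λ { (here refl) → cX , X⊩Z }) , ((Z , cZ) , greatest-singleton (Z , cZ) , Z⊩b)

  to∘from≈id : EqR system system (comp system A system (H to) (H from)) _⊩ᶜ_
  to∘from≈id L T = forth , back
    where
    forth : comp system A system (H to) (H from) L T → L ⊩ᶜ T
    forth ((M , M-max) , _ , cY , L→Y , (_ , Y⊩T)) =
      M , M-max , A.trans (proj₂ M) cY (at-greatest ⊩-upward M-max ∘ L→Y) ∘ Y⊩T
    back : L ⊩ᶜ T → comp system A system (H to) (H from) L T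
    back (M , M-max , M⊩T) =
      let (W , cW , M⊩W , W⊩T) = interpolate A (proj₂ M) M⊩T
      in (M , M-max) , W , cW , (λ p → M , M-max , M⊩W p) , (cW , W⊩T)

module ToCISMap {A B : SCIS} (f : Approx A B) where
  private
    module A = SCIS A
    module 𝒜 = ToCIS A
    module ℬ = ToCIS B

  H-upward : 𝒜.Upward (H f)
  H-upward = record { ≼-closed = λ cX cM X≼M Xb →
    let (Z , cZ , X⊩Z , Zb) = interpolate-left f cX Xb
    in ax-c f cM cZ (X≼M ∘ X⊩Z) Zb }

  ⟶*-upward : 𝒜.Upward (_⟶*_ f)
  ⟶*-upward = 𝒜.Every-upward H-upward

  map : Approx 𝒜.system ℬ.system
  map = record
    { H = λ L T → 𝒜.lift (H f) L (proj₁ T)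
    ; H-Con = λ { (M , M-max , _) → M , M-max }
    ; ax-a = λ { (M , M-max) _ L→Y (N , (N∈Y , _) , N⊩T) →
        M , M-max , ax-a f (proj₂ M) (proj₂ N) (𝒜.at-greatest ⟶*-upward M-max (L→Y N∈Y)) ∘ N⊩T }
    ; ax-b = λ { (M , M-max) _ L′⊆L → 𝒜.AtGreatest-⊆ ⟶*-upward L′⊆L M-max }
    ; ax-c = λ { (M , M-max) _ → 𝒜.AtGreatest-⊩ ⟶*-upward M-max }
    ; ax-d = λ { _ (M , M-max , M⟶T) →
        let (W , cW , M⟶W , W⊩T) = factor-right f (proj₂ M) M⟶T
            (V , cV , M⊩V , V⟶W) = factor-left f (proj₂ M) M⟶W
        in (V , cV) ∷ [] , (W , cW) ∷ []
           , 𝒜.singleton-con (V , cV) , ℬ.singleton-con (W , cW)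
           , (λ { (here refl) → M , M-max , M⊩V })
           , (λ { (here refl) → (V , cV) , 𝒜.greatest-singleton (V , cV) , V⟶W })
           , ((W , cW) , ℬ.greatest-singleton (W , cW) , W⊩T) }
    ; ax-e = λ { {F = F} (M , M-max) L→F →
        let (W , M⟶W , W-max) = ℬ.extend-with-greatest (ax-e f (proj₂ M))
              (λ p → factor-right f (proj₂ M) (𝒜.at-greatest ⟶*-upward M-max (L→F p)))
        in W ∷ F , (W , W-max) , there
           , λ { (here refl) → M , M-max , M⟶W ; (there p) → L→F p } }
    }

  from-natural : EqR 𝒜.system B (comp 𝒜.system ℬ.system B (H ℬ.from) (H map))
                                 (comp 𝒜.system A B (H f) (H 𝒜.from))
  from-natural L b = forth , back
    where
    forth : comp 𝒜.system ℬ.system B (H ℬ.from) (H map) L b →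
            comp 𝒜.system A B (H f) (H 𝒜.from) L b
    forth ((M , M-max) , _ , _ , L→Y , (N , (N∈Y , _) , N⊩b)) =
      let Mb = ax-a f (proj₂ M) (proj₂ N) (𝒜.at-greatest ⟶*-upward M-max (L→Y N∈Y)) N⊩b
          (Z , cZ , M⊩Z , Zb) = interpolate-left f (proj₂ M) Mb
      in (M , M-max) , Z , cZ , (λ p → M , M-max , M⊩Z p) , Zb
    back : comp 𝒜.system A B (H f) (H 𝒜.from) L b →
           comp 𝒜.system ℬ.system B (H ℬ.from) (H map) L b
    back ((M , M-max) , _ , cY , L→Y , Yb) =
      let Mb = ax-c f (proj₂ M) cY (𝒜.at-greatest 𝒜.⊩-upward M-max ∘ L→Y) Yb
          (Z′ , cZ′ , M⟶Z′ , Z′⊩b) = interpolate-right f (proj₂ M) Mb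
      in (M , M-max) , (Z′ , cZ′) ∷ [] , ℬ.singleton-con (Z′ , cZ′)
         , (λ { (here refl) → M , M-max , M⟶Z′ })
         , ((Z′ , cZ′) , ℬ.greatest-singleton (Z′ , cZ′) , Z′⊩b)

open ToCISMap using (map)

map-≈lift : ∀ {A B} (f : Approx A B) (R : Rel A B) → EqR A B (H f) R →
            EqR (ToCIS.system A) (ToCIS.system B) (H (map f)) (λ L T → ToCIS.lift A R L (proj₁ T))
map-≈lift {A} f R f≈R L T = ToCIS.lift-cong A f≈R L (proj₁ T)

map-comp : ∀ {A B C} (f : Approx A B) (g : Approx B C) (h : Approx A C) →
           EqR A C (H h) (comp A B C (H g) (H f)) →
           EqR (ToCIS.system A) (ToCIS.system C) (H (map h))
               (comp (ToCIS.system A) (ToCIS.system B) (ToCIS.system C) (H (map g)) (H (map f)))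
map-comp {A} {B} {C} f g h h≈gf L T = forth , back
  where
  module 𝒜 = ToCIS A
  module ℬ = ToCIS B
  module 𝒞 = ToCIS C
  forth : H (map h) L T →
          comp 𝒜.system ℬ.system 𝒞.system (H (map g)) (H (map f)) L T
  forth (M , M-max , M→T) =
    let (Z , cZ , M⟶Z , Z⟶T) = comp-factor f g (proj₂ M) (proj₁ (h≈gf _ _) ∘ M→T)
    in (M , M-max) , (Z , cZ) ∷ [] , ℬ.singleton-con (Z , cZ)
       , (λ { (here refl) → M , M-max , M⟶Z })
       , ((Z , cZ) , ℬ.greatest-singleton (Z , cZ) , Z⟶T)
  back : comp 𝒜.system ℬ.system 𝒞.system (H (map g)) (H (map f)) L T →
         H (map h) L T
  back ((M , M-max) , _ , _ , L→L′ , (N , (N∈L′ , _) , N⟶T)) =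
    let M⟶N = 𝒜.at-greatest (ToCISMap.⟶*-upward f) M-max (L→L′ N∈L′)
    in M , M-max , λ q → proj₂ (h≈gf _ _) (proj₂ M , proj₁ N , proj₂ N , M⟶N , N⟶T q)

inclusion : Functor CIS-pred SCIS-pred
inclusion = record
  { F₀ = λ A → U A , tt
  ; F₁ = id
  ; F-resp = λ _ _ → id
  ; F-id = λ _ → id
  ; F-comp = λ _ _ _ → id
  }

toCIS : Functor SCIS-pred CIS-pred
toCIS = record
  { F₀ = λ A → ToCIS.system (U A) , ToCIS.isCIS (U A)
  ; F₁ = map
  ; F-resp = λ f g → map-≈lift f (H g)
  ; F-id = λ {A} i → map-≈lift i (idRel (U A))
  ; F-comp = map-comp
  }

theorem4p34 : Equivalence CIS-pred SCIS-pred
theorem4p34 = record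
  { F = inclusion
  ; G = toCIS
  ; unit = record
      { η = λ A → ToCIS.from (U A)
      ; η⁻¹ = λ A → ToCIS.to (U A)
      ; isoˡ = λ A → ToCIS.to∘from≈id (U A)
      ; isoʳ = λ A → ToCIS.from∘to≈id (U A)
      ; natural = ToCISMap.from-natural }
  ; counit = record
      { η = λ A → ToCIS.from (U A)
      ; η⁻¹ = λ A → ToCIS.to (U A)
      ; isoˡ = λ A → ToCIS.to∘from≈id (U A)
      ; isoʳ = λ A → ToCIS.from∘to≈id (U A)
      ; natural = ToCISMap.from-natural }
  }
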